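{- Let $(G,\mathcal R')$ be a yes-instance of $\mathrm{RepExt}(\mathsf{PHCAR})$. Then $(G,\mathcal R')$ is a yes-instance of $\mathrm{RepExt}(\mathsf{NPHCAR})$ if and only if no two predrawn arcs of $\mathcal R'$ are in non-normal position.
   Context: A circular-arc representation assigns closed arcs of a fixed circle to vertices, arcs intersecting iff vertices adjacent. Two arcs are in non-normal position if their intersection is nonempty and disconnected; a representation is normal if no two arcs are in non-normal position, proper if no arc properly contains another, Helly if every family of pairwise intersecting arcs has a common point. $\mathsf{PHCAR}$: proper Helly representations; $\mathsf{NPHCAR}$: normal proper Helly representations. $\mathrm{RepExt}(\mathcal X)$: given $G$ and a representation $\mathcal R'\in\mathcal X$ of an induced subgraph $G'$ (predrawn arcs), decide whether some $\mathcal R\in\mathcal X$ representing $G$ satisfies $R(u)=R'(u)$ for all $u\in V(G')$.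
   Formalization: Points of the circle are taken as the rationals in [0,1), so the predrawn arcs and the arcs of every extending representation have rational endpoints. -}

module Defs where

open import Data.Nat using (ℕ)
open import Data.Fin using (Fin)
open import Data.Bool using (Bool; true)
open import Data.Rational using (ℚ; 0ℚ; 1ℚ; _≤_; _<_)
open import Data.Product using (Σ; ∃; _×_; _,_; proj₁)
open import Data.Sum using (_⊎_)
open import Relation.Nullary using (¬_)
open import Relation.Binary.PropositionalEquality using (_≡_; _≢_)

record Graph (n : ℕ) : Set₁ where
  field
    Adj    : Fin n → Fin n → Set
    sym    : ∀ {u v} → Adj u v → Adj v u
    irrefl : ∀ {u} → ¬ Adj u u
open Graph public

InUnit : ℚ → Set
InUnit x = (0ℚ ≤ x) × (x < 1ℚ)

Pt : Set
Pt = Σ ℚ InUnit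

val : Pt → ℚ
val = proj₁

-- A closed arc, going clockwise from its left endpoint l to its right
-- endpoint r (if r < l the arc wraps around the point 0).
record Arc : Set where
  constructor arc
  field
    l : Pt
    r : Pt
open Arc public

_∈A_ : Pt → Arc → Set
p ∈A a =
  ((val (l a) ≤ val (r a)) × (val (l a) ≤ val p) × (val p ≤ val (r a)))
  ⊎ ((val (r a) < val (l a)) × ((val (l a) ≤ val p) ⊎ (val p ≤ val (r a))))

InOpen : Pt → Pt → Pt → Set
InOpen p q x =
  ((val p < val q) × (val p < val x) × (val x < val q))
  ⊎ ((val q < val p) × ((val p < val x) ⊎ (val x < val q)))

_≡A_ : Arc → Arc → Set
a ≡A b = (val (l a) ≡ val (l b)) × (val (r a) ≡ val (r b))

Intersect : Arc → Arc → Set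
Intersect a b = ∃ λ x → (x ∈A a) × (x ∈A b)

_⊆A_ : Arc → Arc → Set
a ⊆A b = ∀ x → x ∈A a → x ∈A b

_⊂A_ : Arc → Arc → Set
a ⊂A b = (a ⊆A b) × ¬ (b ⊆A a)

-- A subset S of the circle is disconnected iff there are two distinct points
-- p, q outside S such that both open arcs of circle ∖ {p,q} meet S.
Disconnected : (Pt → Set) → Set
Disconnected S =
  Σ Pt λ p → Σ Pt λ q →
    (val p ≢ val q) × ¬ S p × ¬ S q
    × (∃ λ s → S s × InOpen p q s)
    × (∃ λ t → S t × InOpen q p t)

NonNormal : Arc → Arc → Set
NonNormal a b = Intersect a b × Disconnected (λ x → (x ∈A a) × (x ∈A b))

Subset : ℕ → Set
Subset n = Fin n → Bool

_∈S_ : ∀ {n} → Fin n → Subset n → Set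
u ∈S S = S u ≡ true

Proper : ∀ {n} → Subset n → (Fin n → Arc) → Set
Proper S R = ∀ u v → u ∈S S → v ∈S S → u ≢ v → ¬ (R u ⊂A R v)

Helly : ∀ {n} → Subset n → (Fin n → Arc) → Set
Helly {n} S R = (T : Subset n) → (∀ u → u ∈S T → u ∈S S) →
  (∀ u v → u ∈S T → v ∈S T → Intersect (R u) (R v)) →
  ∃ λ x → ∀ u → u ∈S T → x ∈A R u

Normal : ∀ {n} → Subset n → (Fin n → Arc) → Set
Normal S R = ∀ u v → u ∈S S → v ∈S S → u ≢ v → ¬ NonNormal (R u) (R v)

Class : Set₁
Class = ∀ {n} → Subset n → (Fin n → Arc) → Set

PHCAR : Class
PHCAR S R = Proper S R × Helly S R

NPHCAR : Class
NPHCAR S R = Normal S R × Proper S R × Helly S R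

all : ∀ {n} → Subset n
all _ = true

RepresentsOn : ∀ {n} → Graph n → Subset n → (Fin n → Arc) → Set
RepresentsOn G S R = ∀ u v → u ∈S S → v ∈S S → u ≢ v →
  (Adj G u v → Intersect (R u) (R v)) × (Intersect (R u) (R v) → Adj G u v)

Instance : Class → ∀ {n} → Graph n → Subset n → (Fin n → Arc) → Set
Instance X G S R' = X S R' × RepresentsOn G S R'

YesRepExt : Class → ∀ {n} → Graph n → Subset n → (Fin n → Arc) → Set
YesRepExt X G S R' = Instance X G S R' ×
  (Σ (Fin _ → Arc) λ R → X all R × RepresentsOn G all R
     × (∀ u → u ∈S S → R u ≡A R' u))

{-# OPTIONS --safe #-}
-- Necessity holds because the predrawn arcs are kept. For sufficiency, start from any proper
-- Helly extension R. Two arcs in non-normal position cover the circle, so by properness each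
-- of them meets every other arc: only universal vertices take part in non-normal pairs. Giving
-- every universal vertex outside S the arc of one fixed universal vertex p (taken in S when
-- possible) removes all non-normal pairs, while the result stays a proper Helly representation.
module Submission where

open import Defs
open import Data.Nat using (ℕ)
open import Data.Fin using (Fin)
open import Data.Product using (_×_)
open import Relation.Nullary using (¬_)
open import Relation.Binary.PropositionalEquality using (_≢_)

import Data.Bool.Properties as Bool
open import Data.Bool using (true; false)
open import Data.Empty using (⊥; ⊥-elim)
open import Data.Fin.Properties using (any?; all?) renaming (_≟_ to _≟ᶠ_)
open import Data.Product using (Σ; _,_; proj₁; proj₂; map₂)
open import Data.Rational using (ℚ; 1ℚ; _+_; _≤_; _<_)
open import Data.Rational.Properties
  using (≤-refl; ≤-trans; ≤-total; <-trans; <-≤-trans; <⇒≤; <-irrefl; <-asym; ≰⇒>; ≮⇒≥;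
         _≤?_; _<?_; +-monoˡ-≤; +-monoˡ-<)
open import Data.Sum using (_⊎_; inj₁; inj₂; [_,_]′; swap)
open import Relation.Nullary using (Dec; yes; no)
open import Relation.Nullary.Decidable using (_×-dec_; _⊎-dec_; _→-dec_; ¬?; decidable-stable)
open import Relation.Binary.PropositionalEquality using (_≡_; refl; subst; subst₂; ≢-sym)
import Relation.Binary.PropositionalEquality as ≡

<⇒≱ : ∀ {x y : ℚ} → x < y → ¬ y ≤ x
<⇒≱ x<y y≤x = <-irrefl refl (<-≤-trans x<y y≤x)

+1-cancel-≤ : ∀ {x y : ℚ} → x + 1ℚ ≤ y + 1ℚ → x ≤ y
+1-cancel-≤ x+1≤y+1 = ≮⇒≥ λ y<x → <⇒≱ (+-monoˡ-< 1ℚ y<x) x+1≤y+1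

val<val+1 : (y z : Pt) → val y < val z + 1ℚ
val<val+1 (_ , _ , y<1) (_ , 0≤z , _) = <-≤-trans y<1 (+-monoˡ-≤ 1ℚ 0≤z)

∈A? : ∀ x a → Dec (x ∈A a)
∈A? x a =
  ((val (l a) ≤? val (r a)) ×-dec (val (l a) ≤? val x) ×-dec (val x ≤? val (r a)))
  ⊎-dec ((val (r a) <? val (l a)) ×-dec ((val (l a) ≤? val x) ⊎-dec (val x ≤? val (r a))))

l∈A : ∀ a → l a ∈A a
l∈A a with val (l a) ≤? val (r a)
... | yes la≤ra = inj₁ (la≤ra , ≤-refl , la≤ra)
... | no la≰ra = inj₂ (≰⇒> la≰ra , inj₁ ≤-refl)

Intersect-sym : ∀ {a b} → Intersect a b → Intersect b a
Intersect-sym (x , x∈a , x∈b) = x , x∈b , x∈a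

private
  later-left-endpoint : ∀ {a b x} → val (l a) ≤ val (l b) → x ∈A a → x ∈A b → l b ∈A a ⊎ l a ∈A b
  later-left-endpoint la≤lb (inj₂ (ra<la , _)) _ = inj₁ (inj₂ (ra<la , inj₁ la≤lb))
  later-left-endpoint {b = b} {x} la≤lb (inj₁ (la≤ra , la≤x , x≤ra)) x∈b with val (l b) ≤? val x | x∈b
  ... | yes lb≤x | _ = inj₁ (inj₁ (la≤ra , la≤lb , ≤-trans lb≤x x≤ra))
  ... | no lb≰x | inj₁ (_ , lb≤x , _) = ⊥-elim (lb≰x lb≤x)
  ... | no lb≰x | inj₂ (_ , inj₁ lb≤x) = ⊥-elim (lb≰x lb≤x)
  ... | no _ | inj₂ (rb<lb , inj₂ x≤rb) = inj₂ (inj₂ (rb<lb , inj₂ (≤-trans la≤x x≤rb)))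

Intersect⇒left-endpoint : ∀ {a b} → Intersect a b → l b ∈A a ⊎ l a ∈A b
Intersect⇒left-endpoint {a} {b} (x , x∈a , x∈b) with ≤-total (val (l a)) (val (l b))
... | inj₁ la≤lb = later-left-endpoint {a} {b} {x} la≤lb x∈a x∈b
... | inj₂ lb≤la = swap (later-left-endpoint {b} {a} {x} lb≤la x∈b x∈a)

Intersect? : ∀ a b → Dec (Intersect a b)
Intersect? a b with ∈A? (l b) a | ∈A? (l a) b
... | yes lb∈a | _ = yes (l b , lb∈a , l∈A b)
... | no _ | yes la∈b = yes (l a , l∈A a , la∈b)
... | no lb∉a | no la∉b = no λ a∩b → [ lb∉a , la∉b ]′ (Intersect⇒left-endpoint {a} {b} a∩b)

Cyc : ℚ → ℚ → ℚ → Set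
Cyc x y z = (x < y × y < z) ⊎ (y < z × z < x) ⊎ (z < x × x < y)

Cyc-rotate : ∀ {x y z} → Cyc x y z → Cyc y z x
Cyc-rotate (inj₁ xyz) = inj₂ (inj₂ xyz)
Cyc-rotate (inj₂ (inj₁ yzx)) = inj₁ yzx
Cyc-rotate (inj₂ (inj₂ zxy)) = inj₂ (inj₁ zxy)

InOpen⇒Cyc : ∀ {p q s} → InOpen p q s → Cyc (val p) (val s) (val q)
InOpen⇒Cyc (inj₁ (_ , p<s , s<q)) = inj₁ (p<s , s<q)
InOpen⇒Cyc (inj₂ (q<p , inj₁ p<s)) = inj₂ (inj₂ (q<p , p<s))
InOpen⇒Cyc (inj₂ (q<p , inj₂ s<q)) = inj₂ (inj₁ (s<q , q<p))

Between : ℚ → ℚ → ℚ → Set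
Between s m t = (s < m × m < t) ⊎ (t < m × m < s)

Cyc-separation : ∀ {p q s t} → Cyc p s q → Cyc q t p → Between s p t ⊎ Between s q t
Cyc-separation (inj₁ (p<s , s<q)) (inj₁ (q<t , t<p)) = ⊥-elim (<-asym (<-trans p<s s<q) (<-trans q<t t<p))
Cyc-separation (inj₁ (p<s , _)) (inj₂ (inj₁ (t<p , _))) = inj₁ (inj₂ (t<p , p<s))
Cyc-separation (inj₁ (_ , s<q)) (inj₂ (inj₂ (_ , q<t))) = inj₂ (inj₁ (s<q , q<t))
Cyc-separation (inj₂ (inj₁ (s<q , _))) (inj₁ (q<t , _)) = inj₂ (inj₁ (s<q , q<t))
Cyc-separation (inj₂ (inj₁ (_ , q<p))) (inj₂ (inj₁ (_ , p<q))) = ⊥-elim (<-asym q<p p<q)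
Cyc-separation (inj₂ (inj₁ (_ , q<p))) (inj₂ (inj₂ (p<q , _))) = ⊥-elim (<-asym q<p p<q)
Cyc-separation (inj₂ (inj₂ (_ , p<s))) (inj₁ (_ , t<p)) = inj₁ (inj₂ (t<p , p<s))
Cyc-separation (inj₂ (inj₂ (q<p , _))) (inj₂ (inj₁ (_ , p<q))) = ⊥-elim (<-asym q<p p<q)
Cyc-separation (inj₂ (inj₂ (q<p , _))) (inj₂ (inj₂ (p<q , _))) = ⊥-elim (<-asym q<p p<q)

Between-within : ∀ {L R s m t} → L ≤ s × s ≤ R → L ≤ t × t ≤ R → Between s m t → L ≤ m × m ≤ R
Between-within (L≤s , _) (_ , t≤R) (inj₁ (s<m , m<t)) = ≤-trans L≤s (<⇒≤ s<m) , ≤-trans (<⇒≤ m<t) t≤R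
Between-within (_ , s≤R) (L≤t , _) (inj₂ (t<m , m<s)) = ≤-trans L≤t (<⇒≤ t<m) , ≤-trans (<⇒≤ m<s) s≤R

-- Cutting the circle at c and unrolling it onto [val c, val c + 1).
data Lift (c y : Pt) : ℚ → Set where
  unwrapped : val c ≤ val y → Lift c y (val y)
  wrapped   : val y < val c → Lift c y (val y + 1ℚ)

lift : Pt → Pt → ℚ
lift c y with val c ≤? val y
... | yes _ = val y
... | no _ = val y + 1ℚ

lift-view : ∀ c y → Lift c y (lift c y)
lift-view c y with val c ≤? val y
... | yes c≤y = unwrapped c≤y
... | no c≰y = wrapped (≰⇒> c≰y)

lift-ordered : ∀ {c y z w Y Z W} → Lift c y Y → Lift c z Z → Lift c w W →
  val y < val z → val z < val w → Cyc Y Z W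
lift-ordered (unwrapped _) (unwrapped _) (unwrapped _) y<z z<w = inj₁ (y<z , z<w)
lift-ordered {y = y} {w = w} (wrapped _) (unwrapped _) (unwrapped _) _ z<w = inj₂ (inj₁ (z<w , val<val+1 w y))
lift-ordered {y = y} {w = w} (wrapped _) (wrapped _) (unwrapped _) y<z _ =
  inj₂ (inj₂ (val<val+1 w y , +-monoˡ-< 1ℚ y<z))
lift-ordered (wrapped _) (wrapped _) (wrapped _) y<z z<w = inj₁ (+-monoˡ-< 1ℚ y<z , +-monoˡ-< 1ℚ z<w)
lift-ordered (unwrapped c≤y) (wrapped z<c) _ y<z _ = ⊥-elim (<-irrefl refl (<-trans (<-≤-trans z<c c≤y) y<z))
lift-ordered _ (unwrapped c≤z) (wrapped w<c) _ z<w = ⊥-elim (<-irrefl refl (<-trans (<-≤-trans w<c c≤z) z<w))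

lift-Cyc : ∀ {c y z w Y Z W} → Lift c y Y → Lift c z Z → Lift c w W →
  Cyc (val y) (val z) (val w) → Cyc Y Z W
lift-Cyc ly lz lw (inj₁ (y<z , z<w)) = lift-ordered ly lz lw y<z z<w
lift-Cyc ly lz lw (inj₂ (inj₁ (z<w , w<y))) = Cyc-rotate (Cyc-rotate (lift-ordered lz lw ly z<w w<y))
lift-Cyc ly lz lw (inj₂ (inj₂ (w<y , y<z))) = Cyc-rotate (lift-ordered lw ly lz w<y y<z)

-- An arc avoiding c becomes, once unrolled at c, the interval [L , R].
data Unrolled (c : Pt) (a : Arc) : ℚ → ℚ → Set where
  before : val c < val (l a) → val (l a) ≤ val (r a) → Unrolled c a (val (l a)) (val (r a))
  across : val (r a) < val c → val c < val (l a) → Unrolled c a (val (l a)) (val (r a) + 1ℚ)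
  after  : val (r a) < val c → val (l a) ≤ val (r a) → Unrolled c a (val (l a) + 1ℚ) (val (r a) + 1ℚ)

unroll : ∀ {c a L R} → ¬ c ∈A a → Lift c (l a) L → Lift c (r a) R → Unrolled c a L R
unroll {c} {a} c∉a (unwrapped c≤la) (unwrapped c≤ra) with val (l a) ≤? val (r a)
... | yes la≤ra = before (≰⇒> λ la≤c → c∉a (inj₁ (la≤ra , la≤c , c≤ra))) la≤ra
... | no la≰ra = ⊥-elim (c∉a (inj₂ (≰⇒> la≰ra , inj₂ c≤ra)))
unroll c∉a (unwrapped c≤la) (wrapped ra<c) =
  across ra<c (≰⇒> λ la≤c → c∉a (inj₂ (<-≤-trans ra<c c≤la , inj₁ la≤c)))
unroll c∉a (wrapped la<c) (unwrapped c≤ra) =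
  ⊥-elim (c∉a (inj₁ (<⇒≤ (<-≤-trans la<c c≤ra) , <⇒≤ la<c , c≤ra)))
unroll {c} {a} c∉a (wrapped la<c) (wrapped ra<c) with val (l a) ≤? val (r a)
... | yes la≤ra = after ra<c la≤ra
... | no la≰ra = ⊥-elim (c∉a (inj₂ (≰⇒> la≰ra , inj₁ (<⇒≤ la<c))))

∈A⇒unrolled : ∀ {c a y L R Y} → Unrolled c a L R → Lift c y Y → y ∈A a → L ≤ Y × Y ≤ R
∈A⇒unrolled (before _ la≤ra) _ (inj₂ (ra<la , _)) = ⊥-elim (<⇒≱ ra<la la≤ra)
∈A⇒unrolled (before _ _) (unwrapped _) (inj₁ (_ , la≤y , y≤ra)) = la≤y , y≤ra
∈A⇒unrolled (before c<la _) (wrapped y<c) (inj₁ (_ , la≤y , _)) =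
  ⊥-elim (<⇒≱ (<-trans y<c c<la) la≤y)
∈A⇒unrolled (across ra<c c<la) _ (inj₁ (la≤ra , _)) = ⊥-elim (<⇒≱ (<-trans ra<c c<la) la≤ra)
∈A⇒unrolled {a = a} {y} (across _ _) (unwrapped _) (inj₂ (_ , inj₁ la≤y)) = la≤y , <⇒≤ (val<val+1 y (r a))
∈A⇒unrolled (across _ c<la) (wrapped y<c) (inj₂ (_ , inj₁ la≤y)) = ⊥-elim (<⇒≱ (<-trans y<c c<la) la≤y)
∈A⇒unrolled (across ra<c _) (unwrapped c≤y) (inj₂ (_ , inj₂ y≤ra)) =
  ⊥-elim (<⇒≱ ra<c (≤-trans c≤y y≤ra))
∈A⇒unrolled {a = a} {y} (across _ _) (wrapped _) (inj₂ (_ , inj₂ y≤ra)) =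
  <⇒≤ (val<val+1 (l a) y) , +-monoˡ-≤ 1ℚ y≤ra
∈A⇒unrolled (after _ la≤ra) _ (inj₂ (ra<la , _)) = ⊥-elim (<⇒≱ ra<la la≤ra)
∈A⇒unrolled (after ra<c _) (unwrapped c≤y) (inj₁ (_ , _ , y≤ra)) = ⊥-elim (<⇒≱ ra<c (≤-trans c≤y y≤ra))
∈A⇒unrolled (after _ _) (wrapped _) (inj₁ (_ , la≤y , y≤ra)) = +-monoˡ-≤ 1ℚ la≤y , +-monoˡ-≤ 1ℚ y≤ra

unrolled⇒∈A : ∀ {c a y L R Y} → Unrolled c a L R → Lift c y Y → L ≤ Y → Y ≤ R → y ∈A a
unrolled⇒∈A (before _ la≤ra) (unwrapped _) la≤y y≤ra = inj₁ (la≤ra , la≤y , y≤ra)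
unrolled⇒∈A {a = a} {y} (before _ _) (wrapped _) _ y+1≤ra = ⊥-elim (<⇒≱ (val<val+1 (r a) y) y+1≤ra)
unrolled⇒∈A (across ra<c c<la) (unwrapped _) la≤y _ = inj₂ (<-trans ra<c c<la , inj₁ la≤y)
unrolled⇒∈A (across ra<c c<la) (wrapped _) _ y+1≤ra+1 = inj₂ (<-trans ra<c c<la , inj₂ (+1-cancel-≤ y+1≤ra+1))
unrolled⇒∈A {a = a} {y} (after _ _) (unwrapped _) la+1≤y _ = ⊥-elim (<⇒≱ (val<val+1 y (l a)) la+1≤y)
unrolled⇒∈A (after _ la≤ra) (wrapped _) la+1≤y+1 y+1≤ra+1 =
  inj₁ (la≤ra , +1-cancel-≤ la+1≤y+1 , +1-cancel-≤ y+1≤ra+1)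

unrolled-convex : ∀ {c a s t m L R S T M} → Unrolled c a L R → Lift c s S → Lift c t T → Lift c m M →
  s ∈A a → t ∈A a → Between S M T → m ∈A a
unrolled-convex a↓ ls lt lm s∈a t∈a S<M<T =
  let L≤M , M≤R = Between-within (∈A⇒unrolled a↓ ls s∈a) (∈A⇒unrolled a↓ lt t∈a) S<M<T
  in unrolled⇒∈A a↓ lm L≤M M≤R

-- A point outside both arcs would unroll a ∩ b to an interval, which cannot separate p from q.
NonNormal-gap : ∀ {a b x} → NonNormal a b → ¬ x ∈A a → ¬ x ∈A b → ⊥
NonNormal-gap {a} {b} {x} (_ , p , q , _ , p∉ , q∉ , (s , (s∈a , s∈b) , pSq) , (t , (t∈a , t∈b) , qTp))
  x∉a x∉b =
  [ (λ between → p∉ (∈-both p between)) , (λ between → q∉ (∈-both q between)) ]′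
    (Cyc-separation (lifted-Cyc pSq) (lifted-Cyc qTp))
  where
  lifted-Cyc : ∀ {u w v} → InOpen u w v → Cyc (lift x u) (lift x v) (lift x w)
  lifted-Cyc {u} {w} {v} o = lift-Cyc (lift-view x u) (lift-view x v) (lift-view x w) (InOpen⇒Cyc {u} {w} {v} o)

  convex : ∀ {e} → ¬ x ∈A e → s ∈A e → t ∈A e →
    ∀ m → Between (lift x s) (lift x m) (lift x t) → m ∈A e
  convex {e} x∉e s∈e t∈e m = unrolled-convex (unroll {x} {e} x∉e (lift-view x (l e)) (lift-view x (r e)))
    (lift-view x s) (lift-view x t) (lift-view x m) s∈e t∈e

  ∈-both : ∀ m → Between (lift x s) (lift x m) (lift x t) → m ∈A a × m ∈A b
  ∈-both m between = convex {a} x∉a s∈a t∈a m between , convex {b} x∉b s∈b t∈b m between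

NonNormal-covers : ∀ {a b x} → NonNormal a b → ¬ x ∈A a → x ∈A b
NonNormal-covers {a} {b} {x} nn x∉a = decidable-stable (∈A? x b) (NonNormal-gap {a} {b} {x} nn x∉a)

NonNormal-irrefl : ∀ {a} → ¬ NonNormal a a
NonNormal-irrefl {a} nn@(_ , p , _ , _ , p∉ , _) = NonNormal-gap {a} {a} {p} nn p∉a p∉a
  where
  p∉a : ¬ p ∈A a
  p∉a p∈a = p∉ (p∈a , p∈a)

NonNormal-sym : ∀ {a b} → NonNormal a b → NonNormal b a
NonNormal-sym {a} {b} (a∩b , p , q , p≢q , p∉ , q∉ , (s , (s∈a , s∈b) , pSq) , (t , (t∈a , t∈b) , qTp)) =
  Intersect-sym {a} {b} a∩b , p , q , p≢q ,
  (λ (p∈b , p∈a) → p∉ (p∈a , p∈b)) , (λ (q∈b , q∈a) → q∉ (q∈a , q∈b)) ,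
  (s , (s∈b , s∈a) , pSq) , (t , (t∈b , t∈a) , qTp)

NonNormal⇒disjoint-⊂ : ∀ {a b c} → NonNormal a b → ¬ Intersect a c → c ⊂A b
NonNormal⇒disjoint-⊂ {a} {b} {c} nn@((x , x∈a , x∈b) , _) a∩c=∅ =
  (λ y y∈c → NonNormal-covers {a} {b} {y} nn λ y∈a → a∩c=∅ (y , y∈a , y∈c)) ,
  (λ b⊆c → a∩c=∅ (x , x∈a , b⊆c x x∈b))

≡A-sym : ∀ {a b} → a ≡A b → b ≡A a
≡A-sym (refl , refl) = refl , refl

-- Membership only reads the endpoint values, so η for records lets refl patterns identify the arcs.
NonNormal-resp-≡A : ∀ {a a′ b b′} → a ≡A a′ → b ≡A b′ → NonNormal a b → NonNormal a′ b′
NonNormal-resp-≡A (refl , refl) (refl , refl) nn = nn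

Normal-resp-≡A : ∀ {n} {S : Subset n} {R R′ : Fin n → Arc} →
  (∀ u → u ∈S S → R u ≡A R′ u) → Normal S R → Normal S R′
Normal-resp-≡A {R = R} {R′} R≡R′ normal u v u∈S v∈S u≢v nn =
  normal u v u∈S v∈S u≢v (NonNormal-resp-≡A {R′ u} {R u} {R′ v} {R v}
    (≡A-sym {R u} {R′ u} (R≡R′ u u∈S)) (≡A-sym {R v} {R′ v} (R≡R′ v v∈S)) nn)

module Normalisation {n} (G : Graph n) (S : Subset n) (R : Fin n → Arc)
  (proper : Proper all R) (helly : Helly all R) (represents : RepresentsOn G all R)
  (normal-on-S : Normal S R) where

  NormalExtension : Set
  NormalExtension =
    Σ (Fin n → Arc) λ R̃ → NPHCAR all R̃ × RepresentsOn G all R̃ × (∀ u → u ∈S S → R̃ u ≡ R u)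

  Universal : Fin n → Set
  Universal v = ∀ w → w ≢ v → Intersect (R v) (R w)

  universal? : ∀ v → Dec (Universal v)
  universal? v = all? λ w → ¬? (w ≟ᶠ v) →-dec Intersect? (R v) (R w)

  R-⊄ : ∀ u v → ¬ R u ⊂A R v
  R-⊄ u v with u ≟ᶠ v
  ... | yes refl = λ (⊆ , ⊉) → ⊉ ⊆
  ... | no u≢v = proper u v refl refl u≢v

  Universal-meets : ∀ {p} → Universal p → ∀ w → Intersect (R p) (R w)
  Universal-meets {p} p-universal w with w ≟ᶠ p
  ... | yes refl = l (R p) , l∈A (R p) , l∈A (R p)
  ... | no w≢p = p-universal w w≢p

  Universal⇒Adj : ∀ {u v} → Universal u → u ≢ v → Adj G u v
  Universal⇒Adj {u} {v} u-universal u≢v = proj₂ (represents u v refl refl u≢v) (u-universal v (≢-sym u≢v))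

  NonNormal⇒Universal : ∀ {u v} → u ≢ v → NonNormal (R u) (R v) → Universal u
  NonNormal⇒Universal {u} {v} u≢v nn w w≢u with w ≟ᶠ v
  ... | yes refl = proj₁ nn
  ... | no w≢v = decidable-stable (Intersect? (R u) (R w))
    λ u∩w=∅ → proper w v refl refl w≢v (NonNormal⇒disjoint-⊂ {R u} {R v} {R w} nn u∩w=∅)

  Replaced : Fin n → Set
  Replaced x = ¬ x ∈S S × Universal x

  replaced? : ∀ x → Dec (Replaced x)
  replaced? x = ¬? (S x Bool.≟ true) ×-dec universal? x

  ∈S⇒kept : ∀ {x} → x ∈S S → ¬ Replaced x
  ∈S⇒kept x∈S (x∉S , _) = x∉S x∈S

  kept-Universal⇒∈S : ∀ {x} → ¬ Replaced x → Universal x → x ∈S S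
  kept-Universal⇒∈S {x} x-kept x-universal =
    decidable-stable (S x Bool.≟ true) λ x∉S → x-kept (x∉S , x-universal)

  module Replace (p : Fin n) (p-universal : Universal p)
    (compatible : ∀ y → y ≢ p → y ∈S S → Universal y → ¬ NonNormal (R p) (R y)) where

    R̃ : Fin n → Arc
    R̃ x with replaced? x
    ... | yes _ = R p
    ... | no _ = R x

    data Drawn (x : Fin n) : Arc → Set where
      replaced : Replaced x → Drawn x (R p)
      kept     : ¬ Replaced x → Drawn x (R x)

    drawn : ∀ x → Drawn x (R̃ x)
    drawn x with replaced? x
    ... | yes x-replaced = replaced x-replaced
    ... | no x-kept = kept x-kept

    kept-drawn : ∀ {x A} → ¬ Replaced x → Drawn x A → A ≡ R x
    kept-drawn x-kept (replaced x-replaced) = ⊥-elim (x-kept x-replaced)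
    kept-drawn _ (kept _) = refl

    p-normal-to-kept : ∀ {y} → ¬ Replaced y → ¬ NonNormal (R p) (R y)
    p-normal-to-kept {y} y-kept nn with y ≟ᶠ p
    ... | yes refl = NonNormal-irrefl {R p} nn
    ... | no y≢p = compatible y y≢p (kept-Universal⇒∈S y-kept y-universal) y-universal nn
      where
      y-universal : Universal y
      y-universal = NonNormal⇒Universal y≢p (NonNormal-sym {R p} {R y} nn)

    drawn-normal : ∀ {x y A B} → Drawn x A → Drawn y B → x ≢ y → ¬ NonNormal A B
    drawn-normal (replaced _) (replaced _) _ = NonNormal-irrefl {R p}
    drawn-normal (replaced _) (kept y-kept) _ = p-normal-to-kept y-kept
    drawn-normal {x} (kept x-kept) (replaced _) _ nn = p-normal-to-kept x-kept (NonNormal-sym {R x} {R p} nn)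
    drawn-normal {x} {y} (kept x-kept) (kept y-kept) x≢y nn = normal-on-S x y
      (kept-Universal⇒∈S x-kept (NonNormal⇒Universal x≢y nn))
      (kept-Universal⇒∈S y-kept (NonNormal⇒Universal (≢-sym x≢y) (NonNormal-sym {R x} {R y} nn)))
      x≢y nn

    drawn-⊄ : ∀ {x y A B} → Drawn x A → Drawn y B → ¬ A ⊂A B
    drawn-⊄ (replaced _) (replaced _) = R-⊄ p p
    drawn-⊄ {y = y} (replaced _) (kept _) = R-⊄ p y
    drawn-⊄ {x} (kept _) (replaced _) = R-⊄ x p
    drawn-⊄ {x} {y} (kept _) (kept _) = R-⊄ x y

    drawn-represents : ∀ {x y A B} → Drawn x A → Drawn y B → x ≢ y →
      (Adj G x y → Intersect A B) × (Intersect A B → Adj G x y)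
    drawn-represents (replaced (_ , x-universal)) (replaced _) x≢y =
      (λ _ → Universal-meets p-universal p) , (λ _ → Universal⇒Adj x-universal x≢y)
    drawn-represents {y = y} (replaced (_ , x-universal)) (kept _) x≢y =
      (λ _ → Universal-meets p-universal y) , (λ _ → Universal⇒Adj x-universal x≢y)
    drawn-represents {x} (kept _) (replaced (_ , y-universal)) x≢y =
      (λ _ → Intersect-sym {R p} {R x} (Universal-meets p-universal x)) ,
      (λ _ → sym G (Universal⇒Adj y-universal (≢-sym x≢y)))
    drawn-represents {x} {y} (kept _) (kept _) x≢y = represents x y refl refl x≢y

    -- Helly is inherited: a pairwise intersecting family of new arcs is, up to repetitions
    -- of R p, a pairwise intersecting family of old arcs to which R p may be added.
    core : Subset n → Subset n
    core T u with u ≟ᶠ p | replaced? u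
    ... | yes _ | _ = true
    ... | no _ | yes _ = false
    ... | no _ | no _ = T u

    p∈core : ∀ T → p ∈S core T
    p∈core T with p ≟ᶠ p | replaced? p
    ... | yes _ | _ = refl
    ... | no p≢p | _ = ⊥-elim (p≢p refl)

    kept∈core : ∀ T {u} → u ∈S T → ¬ Replaced u → u ∈S core T
    kept∈core T {u} u∈T u-kept with u ≟ᶠ p | replaced? u
    ... | yes _ | _ = refl
    ... | no _ | yes u-replaced = ⊥-elim (u-kept u-replaced)
    ... | no _ | no _ = u∈T

    ∈core : ∀ T {u} → u ∈S core T → u ≡ p ⊎ (u ∈S T × ¬ Replaced u)
    ∈core T {u} u∈core with u ≟ᶠ p | replaced? u
    ... | yes u≡p | _ = inj₁ u≡p
    ... | no _ | no u-kept = inj₂ (u∈core , u-kept)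

    core-pairwise : ∀ T → (∀ u v → u ∈S T → v ∈S T → Intersect (R̃ u) (R̃ v)) →
      ∀ u v → u ∈S core T → v ∈S core T → Intersect (R u) (R v)
    core-pairwise T pairwise u v u∈core v∈core with ∈core T {u} u∈core | ∈core T {v} v∈core
    ... | inj₁ refl | _ = Universal-meets p-universal v
    ... | inj₂ _ | inj₁ refl = Intersect-sym {R v} {R u} (Universal-meets p-universal u)
    ... | inj₂ (u∈T , u-kept) | inj₂ (v∈T , v-kept) =
      subst₂ Intersect (kept-drawn u-kept (drawn u)) (kept-drawn v-kept (drawn v)) (pairwise u v u∈T v∈T)

    drawn-helly : Helly all R̃
    drawn-helly T _ pairwise =
      map₂ (λ {z} z∈core u u∈T → ∈drawn {z} z∈core u∈T (drawn u))
        (helly (core T) (λ _ _ → refl) (core-pairwise T pairwise))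
      where
      ∈drawn : ∀ {z} → (∀ u → u ∈S core T → z ∈A R u) → ∀ {u A} → u ∈S T → Drawn u A → z ∈A A
      ∈drawn z∈core _ (replaced _) = z∈core p (p∈core T)
      ∈drawn z∈core {u} u∈T (kept u-kept) = z∈core u (kept∈core T u∈T u-kept)

    normalised : NormalExtension
    normalised =
      R̃ ,
      ((λ u v _ _ → drawn-normal (drawn u) (drawn v)) , (λ u v _ _ _ → drawn-⊄ (drawn u) (drawn v)) , drawn-helly) ,
      (λ u v _ _ → drawn-represents (drawn u) (drawn v)) ,
      (λ u u∈S → kept-drawn (∈S⇒kept u∈S) (drawn u))

  normalise : NormalExtension
  normalise with any? (λ p → (S p Bool.≟ true) ×-dec universal? p)
  ... | yes (p , p∈S , p-universal) =
    Replace.normalised p p-universal λ y y≢p y∈S _ → normal-on-S p y p∈S y∈S (≢-sym y≢p)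
  ... | no no-universal-in-S with any? universal?
  ...   | yes (p , p-universal) =
    Replace.normalised p p-universal λ y _ y∈S y-universal _ → no-universal-in-S (y , y∈S , y-universal)
  ...   | no no-universal =
    R , ((λ u v _ _ u≢v nn → no-universal (u , NonNormal⇒Universal u≢v nn)) , proper , helly) ,
    represents , λ _ _ → refl

lemma13 : (n : ℕ) (G : Graph n) (S : Subset n) (R' : Fin n → Arc) →
    YesRepExt PHCAR G S R' →
    (YesRepExt NPHCAR G S R' → ∀ u v → u ∈S S → v ∈S S → u ≢ v → ¬ NonNormal (R' u) (R' v))
    × ((∀ u v → u ∈S S → v ∈S S → u ≢ v → ¬ NonNormal (R' u) (R' v)) → YesRepExt NPHCAR G S R')
lemma13 n G S R' (((proper-S , helly-S) , represents-S) , R , (proper , helly) , represents , R≡R') =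
  normal-necessary , normal-sufficient
  where
  normal-necessary : YesRepExt NPHCAR G S R' → Normal S R'
  normal-necessary (_ , R₂ , (normal₂ , _) , _ , R₂≡R') =
    Normal-resp-≡A {R = R₂} {R'} R₂≡R' λ u v _ _ → normal₂ u v refl refl

  normal-sufficient : Normal S R' → YesRepExt NPHCAR G S R'
  normal-sufficient normal-S
    with Normalisation.normalise G S R proper helly represents
           (Normal-resp-≡A {R = R'} {R} (λ u u∈S → ≡A-sym {R u} {R' u} (R≡R' u u∈S)) normal-S)
  ... | R̃ , nphcar , represents̃ , R̃≡R =
    ((normal-S , proper-S , helly-S) , represents-S) ,
    R̃ , nphcar , represents̃ , λ u u∈S → subst (_≡A R' u) (≡.sym (R̃≡R u u∈S)) (R≡R' u u∈S)
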